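{- Let $k\ge 1$ and $l\ge 1$ be integers, let $\mu'=(\mu'_1,\ldots,\mu'_k)$ be a partition, and let $\mu=(\mu'_1,\ldots,\mu'_k,1^l)$ be the partition obtained by appending $l$ parts equal to $1$. For a filling $T$ of shape $\mu$, let $T'$ be the filling of shape $\mu'$ given by $T'_{i,j}=T_{i,j}$ for $(i,j)\in\mu'$, and let $T''$ be the filling of shape $(1^l)$ given by $T''_{i,1}=T_{k+i,1}$ for $1\le i\le l$. Then for every filling $T$ of shape $\mu$, \[ \operatorname{maj}(T)\equiv \operatorname{maj}(T')+\operatorname{maj}(T'')\pmod{l} \quad\text{and}\quad \operatorname{inv}(T)=\operatorname{inv}(T')+\operatorname{inv}(T''). \]
   Context: Diagrams are in French convention: the diagram of a partition $\lambda=(\lambda_1\ge\cdots\ge\lambda_r>0)$ is the set of cells $(i,j)$ with $1\le i\le r$, $1\le j\le\lambda_i$ (row $i$ counted from the bottom, column $j$ from the left). For a cell $u=(i,j)$, $\operatorname{arm}(u)=\lambda_i-j$ is the number of cells strictly to its right and $\operatorname{leg}(u)$ is the number of cells of the diagram strictly above it in column $j$. A filling $T$ of shape $\lambda$ assigns a positive integer $T_{i,j}$ to each cell, with no monotonicity condition. A descent of $T$ is a cell $(i,j)$ with $i\ge 2$ and $T_{i,j}>T_{i-1,j}$; $\operatorname{Des}(T)$ is the set of descents and $\operatorname{maj}(T)=\sum_{u\in\operatorname{Des}(T)}(\operatorname{leg}(u)+1)$. Two distinct cells attack each other if they lie in the same row, or if they are of the form $(i,k)$ and $(i-1,j)$ with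 $j<k$ (consecutive rows, the upper cell strictly to the right of the lower one). The reading order reads rows from top to bottom and each row from left to right. A pair $(u,v)$ of cells is an inversion if $u,v$ attack each other, $T_u<T_v$, and $v$ precedes $u$ in the reading order; $\operatorname{Inv}(T)$ denotes the number of inversions, and $\operatorname{inv}(T)=\operatorname{Inv}(T)-\sum_{u\in\operatorname{Des}(T)}\operatorname{arm}(u)$. These statistics are computed with respect to the shape of the filling in question ($\mu$, $\mu'$ or $(1^l)$). -}

module Defs where

open import Data.Nat using (ℕ; zero; suc; _+_; _∸_; _≤_; _<_; _≤ᵇ_; _<ᵇ_; _≡ᵇ_)
open import Data.Bool using (Bool; true; false; _∧_; _∨_; not; if_then_else_)
open import Data.List using (List; []; _∷_; length; map; concatMap; upTo; reverse)
open import Data.Nat.ListAction using (sum)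
open import Data.List.Relation.Unary.All using (All)
open import Data.List.Relation.Unary.Linked using (Linked)
open import Data.Product using (_×_; _,_; proj₁; proj₂)
open import Data.Integer using (ℤ; +_; _-_)

-- A partition: list of parts λ₁ ≥ λ₂ ≥ ⋯ ≥ λ_r > 0 (row 1 = bottom row).
IsPartition : List ℕ → Set
IsPartition λ′ = All (λ x → 0 < x) λ′ × Linked (λ a b → b ≤ a) λ′

rowLen : List ℕ → ℕ → ℕ
rowLen _ zero = 0
rowLen [] (suc _) = 0
rowLen (x ∷ _) (suc zero) = x
rowLen (_ ∷ xs) (suc (suc i)) = rowLen xs (suc i)

-- [a+1 .. a+n]
range : ℕ → ℕ → List ℕ
range a n = map (λ t → a + suc t) (upTo n)

Cell : Set
Cell = ℕ × ℕ

InDiagram : List ℕ → Cell → Set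
InDiagram λ′ (i , j) = 1 ≤ i × 1 ≤ j × j ≤ rowLen λ′ i

-- All cells of the diagram, listed in reading order
-- (rows from top to bottom, each row from left to right).
cells : List ℕ → List Cell
cells λ′ = concatMap (λ i → map (λ j → (i , j)) (range 0 (rowLen λ′ i)))
                     (reverse (range 0 (length λ′)))

-- A filling assigns an integer to every cell (values off the diagram are irrelevant).
Filling : Set
Filling = ℕ → ℕ → ℕ

PositiveFilling : List ℕ → Filling → Set
PositiveFilling λ′ T = ∀ i j → InDiagram λ′ (i , j) → 1 ≤ T i j

arm : List ℕ → Cell → ℕ
arm λ′ (i , j) = rowLen λ′ i ∸ j

count : {A : Set} → (A → Bool) → List A → ℕ
count p xs = sum (map (λ x → if p x then 1 else 0) xs)

leg : List ℕ → Cell → ℕ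
leg λ′ (i , j) = count (λ i′ → j ≤ᵇ rowLen λ′ i′) (range i (length λ′ ∸ i))

isDes : Filling → Cell → Bool
isDes T (i , j) = (2 ≤ᵇ i) ∧ (T (i ∸ 1) j <ᵇ T i j)

maj : List ℕ → Filling → ℕ
maj λ′ T = sum (map (λ u → if isDes T u then suc (leg λ′ u) else 0) (cells λ′))

sameCell : Cell → Cell → Bool
sameCell (i , j) (i′ , j′) = (i ≡ᵇ i′) ∧ (j ≡ᵇ j′)

attacks : Cell → Cell → Bool
attacks (i , j) (i′ , j′) =
  not (sameCell (i , j) (i′ , j′)) ∧
  ((i ≡ᵇ i′) ∨ (((i ≡ᵇ suc i′) ∧ (j′ <ᵇ j)) ∨ ((i′ ≡ᵇ suc i) ∧ (j <ᵇ j′))))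

precedes : Cell → Cell → Bool
precedes (iv , jv) (iu , ju) = (iu <ᵇ iv) ∨ ((iu ≡ᵇ iv) ∧ (jv <ᵇ ju))

isInversion : Filling → Cell → Cell → Bool
isInversion T u v =
  attacks u v ∧ ((T (proj₁ u) (proj₂ u) <ᵇ T (proj₁ v) (proj₂ v)) ∧ precedes v u)

Inv : List ℕ → Filling → ℕ
Inv λ′ T = sum (map (λ u → count (isInversion T u) (cells λ′)) (cells λ′))

inv : List ℕ → Filling → ℤ
inv λ′ T = + Inv λ′ T - + sum (map (λ u → if isDes T u then arm λ′ u else 0) (cells λ′))

-- T' : restriction of T to shape μ' (same values on the cells of μ')
restrictBottom : Filling → Filling
restrictBottom T = T

restrictTop : ℕ → Filling → Filling
restrictTop k T i j = T (k + i) j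

-- The shape μ′ ++ 1^l is μ′ with a column of l single cells stacked on top of it.  A cell of that
-- column lies in column 1 above every row of μ′, so it attacks no other cell, and its arm is 0:
-- neither Inv nor the arm correction sees the column, which gives the identity for inv.  For maj,
-- a cell of μ′ gains the whole column in its leg exactly when it lies in column 1, i.e. l or 0
-- extra cells; a cell of the column has the same leg and descent status as in T″, except the bottom
-- one, which is never a descent of T″ and, as a descent of T, contributes 1 + (l − 1) = l.

module Submission where

open import Defs
open import Data.Bool using (Bool; true; false; _∧_; if_then_else_)
open import Data.Bool.Properties using (∧-zeroʳ)
open import Data.Nat using (ℕ; zero; suc; _+_; _*_; _∸_; _≤_; _<_; _≤ᵇ_; _≡ᵇ_; z≤n; s≤s)
open import Data.Nat.Properties
  using (_≟_; ≤-trans; ≤-antisym; ≤-<-trans; <⇒≢; >⇒≢; m<n⇒m<1+n; +-comm; +-suc; +-identityʳ;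
         m≤m+n; m<m+n; +-monoʳ-≤; +-∸-comm; m+[n∸m]≡n; m+n∸m≡n; [m+n]∸[m+o]≡n∸o)
open import Data.Nat.ListAction using (sum)
open import Data.Nat.ListAction.Properties using (sum-++)
open import Data.Nat.Solver using (module +-*-Solver)
import Data.Integer as ℤ
import Data.Integer.Properties as ℤP
open import Data.Integer.Divisibility using (_∣_; divides)
open import Data.List using (List; []; _∷_; length; map; concat; concatMap; reverse; _++_; replicate; applyUpTo; upTo)
open import Data.List.Properties
  using (length-++; length-map; length-applyUpTo; length-replicate; map-++; map-∘; map-cong;
         map-cong-local; map-upTo; concatMap-++; concatMap-map; map-concatMap; reverse-++; reverse-map)
open import Data.List.Relation.Unary.All as All using (All; []; _∷_)
open import Data.List.Relation.Unary.All.Properties using (map⁺; ++⁺; concat⁺; applyUpTo⁺₁)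
open import Data.List.Relation.Unary.Any.Properties using (reverse⁻)
open import Data.Product using (_×_; _,_; ∃-syntax)
open import Function using (_∘_; id)
open import Relation.Binary.PropositionalEquality
  using (_≡_; _≢_; refl; sym; trans; cong; cong₂; subst; subst₂; module ≡-Reasoning)
open import Relation.Nullary.Decidable using (dec-false)

open ≡-Reasoning

private
  variable
    A B : Set

All-reverse : {P : A → Set} {xs : List A} → All P xs → All P (reverse xs)
All-reverse pxs = All.tabulate (λ x∈ → All.lookup pxs (reverse⁻ x∈))

concatMap-cong-local : {f g : A → List B} {xs : List A} →
  All (λ x → f x ≡ g x) xs → concatMap f xs ≡ concatMap g xs
concatMap-cong-local eqs = cong concat (map-cong-local eqs)

sum-map-++ : (f : A → ℕ) (xs ys : List A) →
  sum (map f (xs ++ ys)) ≡ sum (map f xs) + sum (map f ys)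
sum-map-++ f xs ys = trans (cong sum (map-++ f xs ys)) (sum-++ (map f xs) (map f ys))

sum-map-cong-local : {f g : A → ℕ} {xs : List A} →
  All (λ x → f x ≡ g x) xs → sum (map f xs) ≡ sum (map g xs)
sum-map-cong-local eqs = cong sum (map-cong-local eqs)

sum-map-zero : {f : A → ℕ} {xs : List A} → All (λ x → f x ≡ 0) xs → sum (map f xs) ≡ 0
sum-map-zero []         = refl
sum-map-zero (e ∷ eqs) = cong₂ _+_ e (sum-map-zero eqs)

if-then-≡0 : ∀ b {x} → x ≡ 0 → (if b then x else 0) ≡ 0
if-then-≡0 true  x≡0 = x≡0
if-then-≡0 false _   = refl

count-++ : (p : A → Bool) (xs ys : List A) → count p (xs ++ ys) ≡ count p xs + count p ys
count-++ p = sum-map-++ (λ x → if p x then 1 else 0)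

count-map : (p : B → Bool) (f : A → B) (xs : List A) → count p (map f xs) ≡ count (p ∘ f) xs
count-map p f xs = cong sum (sym (map-∘ xs))

count-cong-local : {p q : A → Bool} {xs : List A} →
  All (λ x → p x ≡ q x) xs → count p xs ≡ count q xs
count-cong-local eqs = sum-map-cong-local (All.map (cong (if_then 1 else 0)) eqs)

count-const : {p : A → Bool} {b : Bool} {xs : List A} →
  All (λ x → p x ≡ b) xs → count p xs ≡ (if b then length xs else 0)
count-const {b = true}  []         = refl
count-const {b = false} []         = refl
count-const {b = true}  (px≡b ∷ eqs) rewrite px≡b = cong suc (count-const eqs)
count-const {b = false} (px≡b ∷ eqs) rewrite px≡b = count-const eqs

-- Congruence modulo l, one-sided (a exceeds b by a multiple of l) so that the witness stays in ℕ.
infix 4 _≡_mod_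
_≡_mod_ : ℕ → ℕ → ℕ → Set
a ≡ b mod l = ∃[ m ] a ≡ b + m * l

≡⇒≡-mod : ∀ {a b l} → a ≡ b → a ≡ b mod l
≡⇒≡-mod {b = b} refl = 0 , sym (+-identityʳ b)

n≡0-mod-n : ∀ n → n ≡ 0 mod n
n≡0-mod-n n = 1 , sym (+-identityʳ n)

m+n≡m-mod : ∀ {m n l} → n ≡ 0 mod l → m + n ≡ m mod l
m+n≡m-mod (k , refl) = k , refl

if-≡0-mod : ∀ b {x l} → x ≡ 0 mod l → (if b then x else 0) ≡ 0 mod l
if-≡0-mod true  x≡0 = x≡0
if-≡0-mod false _   = 0 , refl

if-cong-mod : ∀ b {x y l} → x ≡ y mod l → (if b then x else 0) ≡ (if b then y else 0) mod l
if-cong-mod true  x≡y = x≡y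
if-cong-mod false _   = 0 , refl

+-cong-mod : ∀ {a b c d l} → a ≡ b mod l → c ≡ d mod l → a + c ≡ b + d mod l
+-cong-mod {b = b} {d = d} {l} (m , refl) (n , refl) =
  m + n , solve 5 (λ b d m n l → (b :+ m :* l) :+ (d :+ n :* l) := (b :+ d) :+ (m :+ n) :* l)
                refl b d m n l
  where open +-*-Solver

sum-map-cong-mod : ∀ {l} {f g : A → ℕ} {xs : List A} →
  All (λ x → f x ≡ g x mod l) xs → sum (map f xs) ≡ sum (map g xs) mod l
sum-map-cong-mod []         = 0 , refl
sum-map-cong-mod (e ∷ eqs) = +-cong-mod e (sum-map-cong-mod eqs)

range-suc : ∀ a n → range a (suc n) ≡ suc a ∷ range (suc a) n
range-suc a n = cong₂ _∷_ (+-comm a 1) (begin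
    map (λ t → a + suc t) (applyUpTo suc n)       ≡⟨ cong (map _) (map-upTo suc n) ⟨
    map (λ t → a + suc t) (map suc (upTo n))      ≡⟨ map-∘ (upTo n) ⟨
    map (λ t → a + suc (suc t)) (upTo n)          ≡⟨ map-cong (λ t → +-suc a (suc t)) (upTo n) ⟩
    range (suc a) n                               ∎)

range-++ : ∀ a m n → range a (m + n) ≡ range a m ++ range (a + m) n
range-++ a zero    n = cong (λ b → range b n) (sym (+-identityʳ a))
range-++ a (suc m) n = begin
    range a (suc (m + n))                            ≡⟨ range-suc a (m + n) ⟩
    suc a ∷ range (suc a) (m + n)                    ≡⟨ cong (suc a ∷_) (range-++ (suc a) m n) ⟩
    suc a ∷ (range (suc a) m ++ range (suc a + m) n) ≡⟨ cong (λ b → suc a ∷ (range (suc a) m ++ range b n)) (+-suc a m) ⟨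
    suc a ∷ (range (suc a) m ++ range (a + suc m) n) ≡⟨ cong (_++ range (a + suc m) n) (range-suc a m) ⟨
    range a (suc m) ++ range (a + suc m) n           ∎

map-+-range : ∀ k a n → map (k +_) (range a n) ≡ range (k + a) n
map-+-range k a zero    = refl
map-+-range k a (suc n) = begin
    map (k +_) (range a (suc n))            ≡⟨ cong (map (k +_)) (range-suc a n) ⟩
    k + suc a ∷ map (k +_) (range (suc a) n) ≡⟨ cong (k + suc a ∷_) (map-+-range k (suc a) n) ⟩
    k + suc a ∷ range (k + suc a) n          ≡⟨ cong (λ b → b ∷ range b n) (+-suc k a) ⟩
    suc (k + a) ∷ range (suc (k + a)) n      ≡⟨ range-suc (k + a) n ⟨
    range (k + a) (suc n)                    ∎

length-range : ∀ a n → length (range a n) ≡ n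
length-range a n = trans (length-map _ (upTo n)) (length-applyUpTo id n)

range-bounds : ∀ a n → All (λ x → a < x × x ≤ a + n) (range a n)
range-bounds a n = map⁺ (applyUpTo⁺₁ id n (λ i<n → m<m+n a (s≤s z≤n) , +-monoʳ-≤ a i<n))

rowLen-++ˡ : ∀ xs ys {i} → i ≤ length xs → rowLen (xs ++ ys) i ≡ rowLen xs i
rowLen-++ˡ xs       ys {zero}        _          = refl
rowLen-++ˡ (x ∷ xs) ys {suc zero}    _          = refl
rowLen-++ˡ (x ∷ xs) ys {suc (suc i)} (s≤s i<n) = rowLen-++ˡ xs ys i<n

rowLen-++ʳ : ∀ xs ys {i} → 0 < i → rowLen (xs ++ ys) (length xs + i) ≡ rowLen ys i
rowLen-++ʳ xs ys {suc t} _ = trans (cong (rowLen (xs ++ ys)) (+-suc (length xs) t)) (above xs)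
  where
  above : ∀ xs → rowLen (xs ++ ys) (suc (length xs + t)) ≡ rowLen ys (suc t)
  above []       = refl
  above (_ ∷ xs) = above xs

rowLen-replicate : ∀ l c {i} → 0 < i → i ≤ l → rowLen (replicate l c) i ≡ c
rowLen-replicate (suc l) c {suc zero}    _ _          = refl
rowLen-replicate (suc l) c {suc (suc i)} _ (s≤s i<l) = rowLen-replicate l c (s≤s z≤n) i<l

0<rowLen⇒≤length : ∀ λ′ i → 0 < rowLen λ′ i → i ≤ length λ′
0<rowLen⇒≤length λ′       zero          _ = z≤n
0<rowLen⇒≤length (_ ∷ _)  (suc zero)    _ = s≤s z≤n
0<rowLen⇒≤length (_ ∷ xs) (suc (suc i)) p = s≤s (0<rowLen⇒≤length xs (suc i) p)

InDiagram⇒≤length : ∀ λ′ {i j} → InDiagram λ′ (i , j) → i ≤ length λ′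
InDiagram⇒≤length λ′ {i} (_ , 0<j , j≤row) = 0<rowLen⇒≤length λ′ i (≤-trans 0<j j≤row)

rowCells : List ℕ → ℕ → List Cell
rowCells λ′ i = map (i ,_) (range 0 (rowLen λ′ i))

shiftUp : ℕ → Cell → Cell
shiftUp n (i , j) = (n + i , j)

cells-InDiagram : ∀ λ′ → All (InDiagram λ′) (cells λ′)
cells-InDiagram λ′ = concat⁺ (map⁺ (All-reverse (All.map row (range-bounds 0 (length λ′)))))
  where
  row : ∀ {i} → 0 < i × i ≤ length λ′ → All (InDiagram λ′) (rowCells λ′ i)
  row (0<i , _) = map⁺ (All.map (λ (0<j , j≤row) → 0<i , 0<j , j≤row) (range-bounds 0 _))

cells-++ : ∀ xs ys → cells (xs ++ ys) ≡ map (shiftUp (length xs)) (cells ys) ++ cells xs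
cells-++ xs ys = begin
    cells (xs ++ ys)                                       ≡⟨ cong (concatMap row ∘ reverse ∘ range 0) (length-++ xs) ⟩
    concatMap row (reverse (range 0 (n + m)))              ≡⟨ cong (concatMap row ∘ reverse) (range-++ 0 n m) ⟩
    concatMap row (reverse (range 0 n ++ range n m))       ≡⟨ cong (concatMap row) (reverse-++ (range 0 n) (range n m)) ⟩
    concatMap row (reverse (range n m) ++ reverse (range 0 n))
                                                           ≡⟨ concatMap-++ row (reverse (range n m)) (reverse (range 0 n)) ⟩
    concatMap row (reverse (range n m)) ++ concatMap row (reverse (range 0 n))
                                                           ≡⟨ cong₂ _++_ upper lower ⟩
    map (shiftUp n) (cells ys) ++ cells xs                 ∎
  where
  n m : ℕ
  n = length xs
  m = length ys
  row : ℕ → List Cell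
  row = rowCells (xs ++ ys)

  upper : concatMap row (reverse (range n m)) ≡ map (shiftUp n) (cells ys)
  upper = begin
      concatMap row (reverse (range n m))                  ≡⟨ cong (λ b → concatMap row (reverse (range b m))) (+-identityʳ n) ⟨
      concatMap row (reverse (range (n + 0) m))            ≡⟨ cong (concatMap row ∘ reverse) (map-+-range n 0 m) ⟨
      concatMap row (reverse (map (n +_) (range 0 m)))     ≡⟨ cong (concatMap row) (reverse-map (n +_) (range 0 m)) ⟨
      concatMap row (map (n +_) (reverse (range 0 m)))     ≡⟨ concatMap-map row (n +_) (reverse (range 0 m)) ⟩
      concatMap (row ∘ (n +_)) (reverse (range 0 m))       ≡⟨ concatMap-cong-local (All-reverse (All.map shifted (range-bounds 0 m))) ⟩
      concatMap (map (shiftUp n) ∘ rowCells ys) (reverse (range 0 m))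
                                                           ≡⟨ map-concatMap (shiftUp n) (rowCells ys) (reverse (range 0 m)) ⟨
      map (shiftUp n) (cells ys)                           ∎
    where
    shifted : ∀ {i} → 0 < i × i ≤ m → row (n + i) ≡ map (shiftUp n) (rowCells ys i)
    shifted {i} (0<i , _) = trans (cong (λ r → map (n + i ,_) (range 0 r)) (rowLen-++ʳ xs ys 0<i)) (map-∘ _)

  lower : concatMap row (reverse (range 0 n)) ≡ cells xs
  lower = concatMap-cong-local (All-reverse (All.map same (range-bounds 0 n)))
    where
    same : ∀ {i} → 0 < i × i ≤ n → row i ≡ rowCells xs i
    same {i} (_ , i≤n) = cong (λ r → map (i ,_) (range 0 r)) (rowLen-++ˡ xs ys i≤n)

sum-cells-++ : (f : Cell → ℕ) (xs ys : List ℕ) →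
  sum (map f (cells (xs ++ ys))) ≡ sum (map (f ∘ shiftUp (length xs)) (cells ys)) + sum (map f (cells xs))
sum-cells-++ f xs ys = begin
    sum (map f (cells (xs ++ ys)))                                  ≡⟨ cong (sum ∘ map f) (cells-++ xs ys) ⟩
    sum (map f (map (shiftUp (length xs)) (cells ys) ++ cells xs))  ≡⟨ sum-map-++ f (map (shiftUp (length xs)) (cells ys)) (cells xs) ⟩
    sum (map f (map (shiftUp (length xs)) (cells ys))) + sum (map f (cells xs))
                                                                    ≡⟨ cong (λ s → sum s + sum (map f (cells xs))) (map-∘ (cells ys)) ⟨
    sum (map (f ∘ shiftUp (length xs)) (cells ys)) + sum (map f (cells xs)) ∎

count-rowLen-++ʳ : ∀ xs ys j a m →
  count (λ r → j ≤ᵇ rowLen (xs ++ ys) r) (range (length xs + a) m) ≡ count (λ r → j ≤ᵇ rowLen ys r) (range a m)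
count-rowLen-++ʳ xs ys j a m = begin
    count p (range (n + a) m)          ≡⟨ cong (count p) (map-+-range n a m) ⟨
    count p (map (n +_) (range a m))   ≡⟨ count-map p (n +_) (range a m) ⟩
    count (p ∘ (n +_)) (range a m)     ≡⟨ count-cong-local (All.map shifted (range-bounds a m)) ⟩
    count (λ r → j ≤ᵇ rowLen ys r) (range a m) ∎
  where
  n : ℕ
  n = length xs
  p : ℕ → Bool
  p r = j ≤ᵇ rowLen (xs ++ ys) r
  shifted : ∀ {r} → a < r × r ≤ a + m → p (n + r) ≡ (j ≤ᵇ rowLen ys r)
  shifted (a<r , _) = cong (j ≤ᵇ_) (rowLen-++ʳ xs ys (≤-trans (s≤s z≤n) a<r))

leg-++ʳ : ∀ xs ys i j → leg (xs ++ ys) (length xs + i , j) ≡ leg ys (i , j)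
leg-++ʳ xs ys i j = begin
    count p (range (n + i) (length (xs ++ ys) ∸ (n + i)))  ≡⟨ cong (λ h → count p (range (n + i) (h ∸ (n + i)))) (length-++ xs) ⟩
    count p (range (n + i) ((n + length ys) ∸ (n + i)))    ≡⟨ cong (count p ∘ range (n + i)) ([m+n]∸[m+o]≡n∸o n (length ys) i) ⟩
    count p (range (n + i) (length ys ∸ i))                ≡⟨ count-rowLen-++ʳ xs ys j i (length ys ∸ i) ⟩
    leg ys (i , j)                                         ∎
  where
  n : ℕ
  n = length xs
  p : ℕ → Bool
  p r = j ≤ᵇ rowLen (xs ++ ys) r

leg-++ˡ : ∀ xs ys {i} j → i ≤ length xs → leg (xs ++ ys) (i , j) ≡ leg xs (i , j) + leg ys (0 , j)
leg-++ˡ xs ys {i} j i≤n = begin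
    count p (range i (length (xs ++ ys) ∸ i))        ≡⟨ cong (count p ∘ range i) rows-above ⟩
    count p (range i ((n ∸ i) + m))                  ≡⟨ cong (count p) (range-++ i (n ∸ i) m) ⟩
    count p (range i (n ∸ i) ++ range (i + (n ∸ i)) m)
                                                     ≡⟨ cong (λ b → count p (range i (n ∸ i) ++ range b m)) (m+[n∸m]≡n i≤n) ⟩
    count p (range i (n ∸ i) ++ range n m)           ≡⟨ count-++ p (range i (n ∸ i)) (range n m) ⟩
    count p (range i (n ∸ i)) + count p (range n m)  ≡⟨ cong₂ _+_ lower upper ⟩
    leg xs (i , j) + leg ys (0 , j)                  ∎
  where
  n m : ℕ
  n = length xs
  m = length ys
  p : ℕ → Bool
  p r = j ≤ᵇ rowLen (xs ++ ys) r

  rows-above : length (xs ++ ys) ∸ i ≡ (n ∸ i) + m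
  rows-above = trans (cong (_∸ i) (length-++ xs)) (+-∸-comm m i≤n)

  lower : count p (range i (n ∸ i)) ≡ leg xs (i , j)
  lower = count-cong-local (All.map same (range-bounds i (n ∸ i)))
    where
    same : ∀ {r} → i < r × r ≤ i + (n ∸ i) → p r ≡ (j ≤ᵇ rowLen xs r)
    same {r} (_ , r≤) = cong (j ≤ᵇ_) (rowLen-++ˡ xs ys (subst (r ≤_) (m+[n∸m]≡n i≤n) r≤))

  upper : count p (range n m) ≡ leg ys (0 , j)
  upper = trans (cong (λ b → count p (range b m)) (sym (+-identityʳ n))) (count-rowLen-++ʳ xs ys j 0 m)

leg-replicate : ∀ l c {i} j → i ≤ l → leg (replicate l c) (i , j) ≡ (if j ≤ᵇ c then l ∸ i else 0)
leg-replicate l c {i} j i≤l = begin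
    count p (range i (length (replicate l c) ∸ i))   ≡⟨ cong (λ h → count p (range i (h ∸ i))) (length-replicate l) ⟩
    count p (range i (l ∸ i))                        ≡⟨ count-const (All.map full (range-bounds i (l ∸ i))) ⟩
    (if j ≤ᵇ c then length (range i (l ∸ i)) else 0) ≡⟨ cong (if j ≤ᵇ c then_else 0) (length-range i (l ∸ i)) ⟩
    (if j ≤ᵇ c then l ∸ i else 0)                    ∎
  where
  p : ℕ → Bool
  p r = j ≤ᵇ rowLen (replicate l c) r
  full : ∀ {r} → i < r × r ≤ i + (l ∸ i) → p r ≡ (j ≤ᵇ c)
  full {r} (i<r , r≤) =
    cong (j ≤ᵇ_) (rowLen-replicate l c (≤-trans (s≤s z≤n) i<r) (subst (r ≤_) (m+[n∸m]≡n i≤l) r≤))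

arm-++ˡ : ∀ xs ys {i j} → i ≤ length xs → arm (xs ++ ys) (i , j) ≡ arm xs (i , j)
arm-++ˡ xs ys {j = j} i≤n = cong (_∸ j) (rowLen-++ˡ xs ys i≤n)

arm-++ʳ : ∀ xs ys {i j} → 0 < i → arm (xs ++ ys) (length xs + i , j) ≡ arm ys (i , j)
arm-++ʳ xs ys {j = j} 0<i = cong (_∸ j) (rowLen-++ʳ xs ys 0<i)

isDes-restrictTop : ∀ n T t j → isDes (restrictTop n T) (suc (suc t) , j) ≡ isDes T (n + suc (suc t) , j)
isDes-restrictTop n T t j rewrite +-suc n (suc t) | +-suc n t = refl

ColumnCellAbove : ℕ → Cell → Set
ColumnCellAbove a (i , j) = a < i × j ≡ 1

CellAtOrBelow : ℕ → Cell → Set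
CellAtOrBelow a (i , j) = i ≤ a × 0 < j

≢⇒≡ᵇ≡false : ∀ m n → m ≢ n → (m ≡ᵇ n) ≡ false
≢⇒≡ᵇ≡false m n = dec-false (m ≟ n)

attacks-column : ∀ {a b u v} → ColumnCellAbove a u → ColumnCellAbove b v → attacks u v ≡ false
attacks-column {u = i , _} {v = i′ , _} (_ , refl) (_ , refl) with i ≡ᵇ i′
... | true  = refl
... | false rewrite ∧-zeroʳ (i ≡ᵇ suc i′) | ∧-zeroʳ (i′ ≡ᵇ suc i) = refl

attacks-above-below : ∀ {a u v} → ColumnCellAbove a u → CellAtOrBelow a v → attacks u v ≡ false
attacks-above-below {u = i , _} {v = i′ , _} (a<i , refl) (i′≤a , s≤s _)
  rewrite ≢⇒≡ᵇ≡false i i′ (>⇒≢ (≤-<-trans i′≤a a<i))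
        | ≢⇒≡ᵇ≡false i′ (suc i) (<⇒≢ (m<n⇒m<1+n (≤-<-trans i′≤a a<i)))
        | ∧-zeroʳ (i ≡ᵇ suc i′) = refl

attacks-below-above : ∀ {a u v} → CellAtOrBelow a u → ColumnCellAbove a v → attacks u v ≡ false
attacks-below-above {u = i , _} {v = i′ , _} (i≤a , s≤s _) (a<i′ , refl)
  rewrite ≢⇒≡ᵇ≡false i i′ (<⇒≢ (≤-<-trans i≤a a<i′))
        | ≢⇒≡ᵇ≡false i (suc i′) (<⇒≢ (m<n⇒m<1+n (≤-<-trans i≤a a<i′)))
        | ∧-zeroʳ (i′ ≡ᵇ suc i) = refl

isInversion-nonattacking : ∀ T u v → attacks u v ≡ false → isInversion T u v ≡ false
isInversion-nonattacking T u v attacks≡false rewrite attacks≡false = refl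

pairCount : (A → A → Bool) → List A → ℕ
pairCount r xs = sum (map (λ u → count (r u) xs) xs)

Unrelated : (A → A → Bool) → List A → List A → Set
Unrelated r xs ys = All (λ u → All (λ v → r u v ≡ false) ys) xs

unrelated : {r : A → A → Bool} {P Q : A → Set} {xs ys : List A} →
  (∀ {u v} → P u → Q v → r u v ≡ false) → All P xs → All Q ys → Unrelated r xs ys
unrelated r≡false ps qs = All.map (λ pu → All.map (r≡false pu) qs) ps

Unrelated-isInversion : ∀ T {xs ys} → Unrelated attacks xs ys → Unrelated (isInversion T) xs ys
Unrelated-isInversion T = All.map (λ {u} → All.map (λ {v} → isInversion-nonattacking T u v))

pairCount-unrelated : {r : A → A → Bool} {xs : List A} → Unrelated r xs xs → pairCount r xs ≡ 0
pairCount-unrelated unrel = sum-map-zero (All.map count-const unrel)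

pairCount-++-unrelated : {r : A → A → Bool} {xs ys : List A} →
  Unrelated r xs (xs ++ ys) → Unrelated r ys xs → pairCount r (xs ++ ys) ≡ pairCount r ys
pairCount-++-unrelated {r = r} {xs} {ys} xs-unrel ys-unrel = begin
    sum (map (λ u → count (r u) (xs ++ ys)) (xs ++ ys))
  ≡⟨ sum-map-++ (λ u → count (r u) (xs ++ ys)) xs ys ⟩
    sum (map (λ u → count (r u) (xs ++ ys)) xs) + sum (map (λ u → count (r u) (xs ++ ys)) ys)
  ≡⟨ cong₂ _+_ (sum-map-zero (All.map count-const xs-unrel)) (sum-map-cong-local (All.map drop-xs ys-unrel)) ⟩
    pairCount r ys
  ∎
  where
  drop-xs : ∀ {u} → All (λ v → r u v ≡ false) xs → count (r u) (xs ++ ys) ≡ count (r u) ys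
  drop-xs {u} r≡false = trans (count-++ (r u) xs ys) (cong (_+ count (r u) ys) (count-const r≡false))

column : ℕ → List ℕ
column l = replicate l 1

InDiagram-column : ∀ l {i j} → InDiagram (column l) (i , j) → 0 < i × i ≤ l × j ≡ 1
InDiagram-column l {i} {j} d@(0<i , 0<j , j≤row) =
  0<i , i≤l , ≤-antisym (subst (j ≤_) (rowLen-replicate l 1 0<i i≤l) j≤row) 0<j
  where
  i≤l : i ≤ l
  i≤l = subst (i ≤_) (length-replicate l) (InDiagram⇒≤length (column l) d)

column-cells : ∀ l → All (ColumnCellAbove 0) (cells (column l))
column-cells l = All.map column-cell (cells-InDiagram (column l))
  where
  column-cell : ∀ {i j} → InDiagram (column l) (i , j) → ColumnCellAbove 0 (i , j)
  column-cell d with InDiagram-column l d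
  ... | 0<i , _ , j≡1 = 0<i , j≡1

shifted-column-cells : ∀ n l → All (ColumnCellAbove n) (map (shiftUp n) (cells (column l)))
shifted-column-cells n l = map⁺ (All.map (λ (0<i , j≡1) → m<m+n n 0<i , j≡1) (column-cells l))

cells-AtOrBelow : ∀ λ′ → All (CellAtOrBelow (length λ′)) (cells λ′)
cells-AtOrBelow λ′ = All.map (λ d@(_ , 0<j , _) → InDiagram⇒≤length λ′ d , 0<j) (cells-InDiagram λ′)

arm-column : ∀ l {i j} → InDiagram (column l) (i , j) → arm (column l) (i , j) ≡ 0
arm-column l d with InDiagram-column l d
... | 0<i , i≤l , refl = cong (_∸ 1) (rowLen-replicate l 1 0<i i≤l)

leg-column-base : ∀ l j → leg (column l) (0 , j) ≡ 0 mod l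
leg-column-base l j = subst (_≡ 0 mod l) (sym (leg-replicate l 1 j z≤n)) (if-≡0-mod (j ≤ᵇ 1) (n≡0-mod-n l))

Inv-++-column : ∀ μ l T → Inv (μ ++ column l) T ≡ Inv μ T
Inv-++-column μ l T = begin
    pairCount (isInversion T) (cells (μ ++ column l))
  ≡⟨ cong (pairCount (isInversion T)) (cells-++ μ (column l)) ⟩
    pairCount (isInversion T) (top ++ cells μ)
  ≡⟨ pairCount-++-unrelated (Unrelated-isInversion T top-isolated) (Unrelated-isInversion T bottom-isolated) ⟩
    Inv μ T
  ∎
  where
  top : List Cell
  top = map (shiftUp (length μ)) (cells (column l))
  top-isolated : Unrelated attacks top (top ++ cells μ)
  top-isolated = All.map (λ above → ++⁺ (All.map (attacks-column above) (shifted-column-cells (length μ) l))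
                                         (All.map (attacks-above-below above) (cells-AtOrBelow μ)))
                         (shifted-column-cells (length μ) l)
  bottom-isolated : Unrelated attacks (cells μ) top
  bottom-isolated = unrelated attacks-below-above (cells-AtOrBelow μ) (shifted-column-cells (length μ) l)

Inv-column : ∀ l T → Inv (column l) T ≡ 0
Inv-column l T =
  pairCount-unrelated (Unrelated-isInversion T (unrelated attacks-column (column-cells l) (column-cells l)))

armTerm : List ℕ → Filling → Cell → ℕ
armTerm λ′ T u = if isDes T u then arm λ′ u else 0

armSum : List ℕ → Filling → ℕ
armSum λ′ T = sum (map (armTerm λ′ T) (cells λ′))

armSum-++-column : ∀ μ l T → armSum (μ ++ column l) T ≡ armSum μ T
armSum-++-column μ l T = begin
    armSum ν T
  ≡⟨ sum-cells-++ (armTerm ν T) μ (column l) ⟩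
    sum (map (armTerm ν T ∘ shiftUp (length μ)) (cells (column l))) + sum (map (armTerm ν T) (cells μ))
  ≡⟨ cong₂ _+_ (sum-map-zero (All.map top (cells-InDiagram (column l))))
               (sum-map-cong-local (All.map bottom (cells-InDiagram μ))) ⟩
    armSum μ T
  ∎
  where
  ν : List ℕ
  ν = μ ++ column l
  top : ∀ {i j} → InDiagram (column l) (i , j) → armTerm ν T (length μ + i , j) ≡ 0
  top {i} {j} d@(0<i , _) =
    if-then-≡0 (isDes T (length μ + i , j)) (trans (arm-++ʳ μ (column l) {j = j} 0<i) (arm-column l d))
  bottom : ∀ {i j} → InDiagram μ (i , j) → armTerm ν T (i , j) ≡ armTerm μ T (i , j)
  bottom {i} {j} d = cong (if isDes T (i , j) then_else 0) (arm-++ˡ μ (column l) {j = j} (InDiagram⇒≤length μ d))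

armSum-column : ∀ l T → armSum (column l) T ≡ 0
armSum-column l T =
  sum-map-zero (All.map (λ {u} d → if-then-≡0 (isDes T u) (arm-column l d)) (cells-InDiagram (column l)))

majTerm : List ℕ → Filling → Cell → ℕ
majTerm λ′ T u = if isDes T u then suc (leg λ′ u) else 0

maj-++-column : ∀ μ l T → maj (μ ++ column l) T ≡ maj μ T + maj (column l) (restrictTop (length μ) T) mod l
maj-++-column μ l T =
  subst₂ (_≡_mod l) (sym (sum-cells-++ (majTerm ν T) μ (column l))) (+-comm (maj (column l) T″) (maj μ T))
    (+-cong-mod (sum-map-cong-mod (All.map top (cells-InDiagram (column l))))
                (sum-map-cong-mod (All.map bottom (cells-InDiagram μ))))
  where
  n : ℕ
  n = length μ
  ν : List ℕ
  ν = μ ++ column l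
  T″ : Filling
  T″ = restrictTop n T

  top : ∀ {i j} → InDiagram (column l) (i , j) → majTerm ν T (n + i , j) ≡ majTerm (column l) T″ (i , j) mod l
  top d with InDiagram-column l d
  top {suc zero}    d | _ , 1≤l , refl =
    if-≡0-mod (isDes T (n + 1 , 1)) (subst (_≡ 0 mod l) (sym base-leg) (n≡0-mod-n l))
    where
    base-leg : suc (leg ν (n + 1 , 1)) ≡ l
    base-leg = trans (cong suc (trans (leg-++ʳ μ (column l) 1 1) (leg-replicate l 1 1 1≤l))) (m+[n∸m]≡n 1≤l)
  top {suc (suc t)} d | _ , _ , refl = ≡⇒≡-mod
    (cong₂ (λ b k → if b then suc k else 0) (sym (isDes-restrictTop n T t 1)) (leg-++ʳ μ (column l) (suc (suc t)) 1))

  bottom : ∀ {i j} → InDiagram μ (i , j) → majTerm ν T (i , j) ≡ majTerm μ T (i , j) mod l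
  bottom {i} {j} d = if-cong-mod (isDes T (i , j))
    (subst (λ k → suc k ≡ suc (leg μ (i , j)) mod l) (sym (leg-++ˡ μ (column l) j (InDiagram⇒≤length μ d)))
           (m+n≡m-mod (leg-column-base l j)))

-- Imported only here: its prefix +_ would make the sections (n +_) above ambiguous.
open import Data.Integer using (+_; _-_)

≡-mod⇒∣ : ∀ {a b l} → a ≡ b mod l → + l ∣ + a - + b
≡-mod⇒∣ {b = b} {l} (m , refl) = divides m (begin
    ℤ.∣ + (b + m * l) - + b ∣   ≡⟨ cong ℤ.∣_∣ (ℤP.m-n≡m⊖n (b + m * l) b) ⟩
    ℤ.∣ (b + m * l) ℤ.⊖ b ∣     ≡⟨ cong ℤ.∣_∣ (ℤP.⊖-≥ (m≤m+n b (m * l))) ⟩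
    b + m * l ∸ b               ≡⟨ m+n∸m≡n b (m * l) ⟩
    m * l                       ∎)

inv-++-column : ∀ μ l T → inv (μ ++ column l) T ≡ inv μ T
inv-++-column μ l T = cong₂ (λ a b → + a - + b) (Inv-++-column μ l T) (armSum-++-column μ l T)

inv-column : ∀ l T → inv (column l) T ≡ ℤ.0ℤ
inv-column l T = cong₂ (λ a b → + a - + b) (Inv-column l T) (armSum-column l T)

theorem3 : (k l : ℕ) → 1 ≤ k → 1 ≤ l →
    (μ′ : List ℕ) → IsPartition μ′ → length μ′ ≡ k →
    (T : Filling) → PositiveFilling (μ′ ++ replicate l 1) T →
    ((+ l) ∣ (+ maj (μ′ ++ replicate l 1) T
               - (+ maj μ′ (restrictBottom T) ℤ.+ + maj (replicate l 1) (restrictTop k T))))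
    × (inv (μ′ ++ replicate l 1) T
       ≡ inv μ′ (restrictBottom T) ℤ.+ inv (replicate l 1) (restrictTop k T))
theorem3 .(length μ′) l _ _ μ′ _ refl T _ = maj-divisible , inv-additive
  where
  T″ : Filling
  T″ = restrictTop (length μ′) T

  maj-divisible : + l ∣ + maj (μ′ ++ column l) T - (+ maj μ′ T ℤ.+ + maj (column l) T″)
  maj-divisible = subst (λ z → + l ∣ + maj (μ′ ++ column l) T - z) (ℤP.pos-+ (maj μ′ T) (maj (column l) T″))
                        (≡-mod⇒∣ (maj-++-column μ′ l T))

  inv-additive : inv (μ′ ++ column l) T ≡ inv μ′ T ℤ.+ inv (column l) T″
  inv-additive = begin
    inv (μ′ ++ column l) T            ≡⟨ inv-++-column μ′ l T ⟩
    inv μ′ T                          ≡⟨ ℤP.+-identityʳ (inv μ′ T) ⟨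
    inv μ′ T ℤ.+ ℤ.0ℤ                 ≡⟨ cong (λ z → inv μ′ T ℤ.+ z) (inv-column l T″) ⟨
    inv μ′ T ℤ.+ inv (column l) T″    ∎
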